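{- Let $k$ be a positive integer, let $c(n,k)$ be defined by $(1-k^2x)^{ -1/k}=\sum_{n\ge 0}c(n,k)x^n$, and let $p$ be a prime not dividing $k$. Write $n=\sum_{m\ge0}a_mp^m$ in base $p$ (digits $0\le a_m\le p-1$), and write the $p$-adic integer $1/k$ as $1/k=1+\sum_{m\ge 0}b_mp^m$ with digits $0\le b_m\le p-1$. Let $v_1$ be the number of indices $m\ge0$ with $a_m+b_m\ge p$ and $v_2$ the number of indices $m\ge 0$ with $a_m+b_m\ge p-1$. Then $$v_1\le \nu_p(c(n,k))\le v_2.$$
   Context: $\nu_p(N)$ denotes the exponent of the highest power of $p$ dividing the integer $N$. -}

module Defs where

open import Data.Nat using (ℕ; zero; suc; _+_; _*_; _∸_; _^_; _≤_; _≤?_; NonZero)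
open import Data.Nat.DivMod using (_/_; _%_)
open import Data.Nat using (_!)
open import Data.Nat.Properties using (_!≢0)
open import Data.List using (List; length; filter; upTo; map)
open import Data.Nat.ListAction using (sum; product)

risingProd : ℕ → ℕ → ℕ
risingProd n k = product (map (λ j → 1 + j * k) (upTo n))

-- c(n,k) = [x^n] (1 - k^2 x)^(-1/k) = binom(-1/k, n) (-k^2)^n
--        = k^n * ∏_{j<n} (1 + j k) / n!   (an exact division)
c : ℕ → ℕ → ℕ
c n k = (k ^ n * risingProd n k) / (n !)
  where instance _ = n !≢0

digit : (p : ℕ) .{{_ : NonZero p}} → ℕ → ℕ → ℕ
digit p n zero = n % p
digit p n (suc m) = digit p (n / p) m

countGE : ℕ → (ℕ → ℕ) → (ℕ → ℕ) → ℕ → ℕ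
countGE t a b L = length (filter (λ m → t ≤? a m + b m) (upTo L))

partialSum : ℕ → (ℕ → ℕ) → ℕ → ℕ
partialSum p b M = sum (map (λ m → b m * p ^ m) (upTo M))

-- b is the digit sequence of the p-adic integer 1/k - 1, i.e.
-- 1/k = 1 + Σ_{m≥0} b_m p^m with 0 ≤ b_m ≤ p - 1
open import Data.Nat.Divisibility using (_∣_)
open import Data.Nat using (_<_)
open import Data.Product using (_×_)
IsInvDigits : ℕ → ℕ → (ℕ → ℕ) → Set
IsInvDigits p k b = (∀ m → b m < p) × (∀ M → p ^ M ∣ (k * (1 + partialSum p b M) ∸ 1))

module Submission where

-- Write R = ∏_{j<n}(1+jk) and choose Bᵢ with k(1+Bᵢ) ≡ 1 (mod p^{i+1}).  Then
-- p^{i+1} ∣ 1+jk  iff  p^{i+1} ∣ Bᵢ+j+1, so counting, for each level i, the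
-- factors divisible by p^{i+1} gives
--     ν_p(R)  = Σᵢ #{1 ≤ j ≤ n : p^{i+1} ∣ Bᵢ + j} = Σᵢ (⌊(Bᵢ+n)/p^{i+1}⌋ − ⌊Bᵢ/p^{i+1}⌋),
--     ν_p(n!) = Σᵢ ⌊n/p^{i+1}⌋                                  (Legendre, k = 1).
-- With Bᵢ = Σ_{m≤i} b_m p^m < p^{i+1} the difference of the two summands is the
-- carry out of digit i when adding Bᵢ and n in base p, and that carry is 1 when
-- aᵢ+bᵢ ≥ p and 0 when aᵢ+bᵢ < p−1.  Hence v₁ ≤ ν_p(c(n,k)) ≤ v₂.

open import Defs
open import Data.Nat using (ℕ; suc; _^_; _∸_; _≤_; NonZero)
open import Data.Nat.Divisibility using (_∣_)
open import Data.Nat.Primality using (Prime)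
open import Data.Product using (∃; _×_)
open import Relation.Nullary using (¬_)

open import Data.Nat
open import Data.Nat.Properties
open import Data.Nat.Divisibility
open import Data.Nat.DivMod
open import Data.Nat.Induction using (<-rec)
open import Data.Nat.GCD using (gcd; gcd[m,n]∣m; gcd[m,n]∣n; module Bézout)
open import Data.Nat.Coprimality using (Coprime; coprime-divisor; coprime-Bézout; gcd≡1⇒coprime; 1-coprimeTo)
  renaming (sym to coprime-sym)
open import Data.Nat.Primality using (prime⇒nonZero; prime⇒nonTrivial; prime⇒irreducible; euclidsLemma)
open import Data.Nat.Primality.Factorisation using (factorise; PrimeFactorisation)
open import Data.Nat.ListAction using (sum; product)
open import Data.Nat.ListAction.Properties using (sum-++; product-++)
open import Data.Nat.Tactic.RingSolver using (solve-∀)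
open import Data.List using ([]; _∷_; _++_; length; filter; upTo; map; [_])
open import Data.List.Properties using (upTo-∷ʳ; map-++; filter-++; length-++; filter-accept; filter-reject)
open import Data.List.Relation.Unary.All using (All; []; _∷_)
open import Data.Product using (_,_; proj₁; proj₂)
open import Data.Sum using (inj₁; inj₂)
open import Data.Empty using (⊥-elim)
open import Relation.Nullary using (Dec; yes; no)
open import Relation.Nullary.Decidable using (decidable-stable)
open import Relation.Binary.PropositionalEquality hiding ([_])

𝟙 : ∀ {a} {A : Set a} → Dec A → ℕ
𝟙 (yes _) = 1
𝟙 (no _)  = 0

𝟙-mono : ∀ {a b} {A : Set a} {B : Set b} (da : Dec A) (db : Dec B) → (A → B) → 𝟙 da ≤ 𝟙 db
𝟙-mono (yes x) (yes _) _ = ≤-refl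
𝟙-mono (yes x) (no ¬y) f = ⊥-elim (¬y (f x))
𝟙-mono (no _)  _       _ = z≤n

𝟙-cong : ∀ {a b} {A : Set a} {B : Set b} (da : Dec A) (db : Dec B) →
         (A → B) → (B → A) → 𝟙 da ≡ 𝟙 db
𝟙-cong da db f g = ≤-antisym (𝟙-mono da db f) (𝟙-mono db da g)

sumTo : ℕ → (ℕ → ℕ) → ℕ
sumTo zero    f = 0
sumTo (suc T) f = sumTo T f + f T

sumTo-cong : ∀ T {f g} → (∀ i → f i ≡ g i) → sumTo T f ≡ sumTo T g
sumTo-cong zero    f≡g = refl
sumTo-cong (suc T) f≡g = cong₂ _+_ (sumTo-cong T f≡g) (f≡g T)

sumTo-mono : ∀ T {f g} → (∀ i → f i ≤ g i) → sumTo T f ≤ sumTo T g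
sumTo-mono zero    f≤g = z≤n
sumTo-mono (suc T) f≤g = +-mono-≤ (sumTo-mono T f≤g) (f≤g T)

sumTo-zero : ∀ T → sumTo T (λ _ → 0) ≡ 0
sumTo-zero zero    = refl
sumTo-zero (suc T) = cong (_+ 0) (sumTo-zero T)

+-swap-middle : ∀ a b c d → a + b + (c + d) ≡ a + c + (b + d)
+-swap-middle = solve-∀

sumTo-+ : ∀ T f g → sumTo T (λ i → f i + g i) ≡ sumTo T f + sumTo T g
sumTo-+ zero    f g = refl
sumTo-+ (suc T) f g = trans (cong (_+ (f T + g T)) (sumTo-+ T f g))
                            (+-swap-middle (sumTo T f) (sumTo T g) (f T) (g T))

sumTo-extend : ∀ f {T T′} → T ≤ T′ → sumTo T f ≤ sumTo T′ f
sumTo-extend f {T} {zero}   z≤n = ≤-refl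
sumTo-extend f {T} {suc T′} T≤ with T ≤? T′
... | yes T≤T′ = ≤-trans (sumTo-extend f T≤T′) (m≤m+n _ _)
... | no  T≰T′ = ≤-reflexive (cong (λ t → sumTo t f) (≤-antisym T≤ (≰⇒> T≰T′)))

sumTo-threshold : ∀ T e → sumTo T (λ i → 𝟙 (suc i ≤? e)) ≡ T ⊓ e
sumTo-threshold zero    e = refl
sumTo-threshold (suc T) e with suc T ≤? e
... | yes T<e = trans (cong (_+ 1) (trans (sumTo-threshold T e) (m≤n⇒m⊓n≡m (<⇒≤ T<e))))
                      (trans (+-comm T 1) (sym (m≤n⇒m⊓n≡m T<e)))
... | no  T≮e = trans (+-identityʳ _) (trans (sumTo-threshold T e)
                  (trans (m≥n⇒m⊓n≡n e≤T) (sym (m≥n⇒m⊓n≡n (m≤n⇒m≤1+n e≤T)))))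
  where
  e≤T : e ≤ T
  e≤T = ≤-pred (≰⇒> T≮e)

map-upTo-suc : ∀ (f : ℕ → ℕ) n → map f (upTo (suc n)) ≡ map f (upTo n) ++ [ f n ]
map-upTo-suc f n = trans (cong (map f) (sym (upTo-∷ʳ n))) (map-++ f (upTo n) [ n ])

countGE≡sumTo : ∀ t a b L → countGE t a b L ≡ sumTo L (λ m → 𝟙 (t ≤? a m + b m))
countGE≡sumTo t a b zero    = refl
countGE≡sumTo t a b (suc L) = begin
  length (filter P? (upTo (suc L)))                 ≡⟨ cong (λ xs → length (filter P? xs)) (sym (upTo-∷ʳ L)) ⟩
  length (filter P? (upTo L ++ [ L ]))              ≡⟨ cong length (filter-++ P? (upTo L) [ L ]) ⟩
  length (filter P? (upTo L) ++ filter P? [ L ])    ≡⟨ length-++ (filter P? (upTo L)) ⟩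
  countGE t a b L + length (filter P? [ L ])        ≡⟨ cong₂ _+_ (countGE≡sumTo t a b L) last ⟩
  sumTo L (λ m → 𝟙 (P? m)) + 𝟙 (P? L)               ∎
  where
  open ≡-Reasoning
  P? : ∀ m → Dec (t ≤ a m + b m)
  P? m = t ≤? a m + b m
  last : length (filter P? [ L ]) ≡ 𝟙 (P? L)
  last with P? L
  ... | yes PL = cong length (filter-accept P? {L} {[]} PL)
  ... | no ¬PL = cong length (filter-reject P? {L} {[]} ¬PL)

partialSum-suc : ∀ p b M → partialSum p b (suc M) ≡ partialSum p b M + b M * p ^ M
partialSum-suc p b M =
  trans (cong sum (map-upTo-suc (λ m → b m * p ^ m) M))
        (trans (sum-++ (map (λ m → b m * p ^ m) (upTo M)) [ b M * p ^ M ])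
               (cong (partialSum p b M +_) (+-identityʳ _)))

risingProd-suc : ∀ n k → risingProd (suc n) k ≡ risingProd n k * (1 + n * k)
risingProd-suc n k =
  trans (cong product (map-upTo-suc (λ j → 1 + j * k) n))
        (trans (product-++ (map (λ j → 1 + j * k) (upTo n)) [ 1 + n * k ])
               (cong (risingProd n k *_) (*-identityʳ _)))

risingProd-1 : ∀ n → risingProd n 1 ≡ n !
risingProd-1 zero    = refl
risingProd-1 (suc n) = begin
  risingProd (suc n) 1       ≡⟨ risingProd-suc n 1 ⟩
  risingProd n 1 * (1 + n * 1) ≡⟨ cong₂ (λ x y → x * (1 + y)) (risingProd-1 n) (*-identityʳ n) ⟩
  n ! * suc n                ≡⟨ *-comm (n !) (suc n) ⟩
  suc n !                    ∎
  where open ≡-Reasoning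

risingProd≢0 : ∀ n k → risingProd n k ≢ 0
risingProd≢0 zero    k ()
risingProd≢0 (suc n) k eq with m*n≡0⇒m≡0∨n≡0 (risingProd n k) (trans (sym (risingProd-suc n k)) eq)
... | inj₁ R≡0 = risingProd≢0 n k R≡0
... | inj₂ ()

coprime-* : ∀ {a b m} → Coprime a m → Coprime b m → Coprime (a * b) m
coprime-* {a} {b} {m} a⊥m b⊥m {d} (d∣ab , d∣m) = b⊥m (d∣b , d∣m)
  where
  d⊥a : gcd d a ≡ 1
  d⊥a = a⊥m (gcd[m,n]∣n d a , ∣-trans (gcd[m,n]∣m d a) d∣m)
  d∣b : d ∣ b
  d∣b = coprime-divisor (gcd≡1⇒coprime d⊥a) d∣ab

coprime-^ : ∀ {a m} e → Coprime a m → Coprime (a ^ e) m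
coprime-^ {m = m} zero    a⊥m = 1-coprimeTo m
coprime-^         (suc e) a⊥m = coprime-* a⊥m (coprime-^ e a⊥m)

prime∤⇒coprime : ∀ {q m} → Prime q → ¬ q ∣ m → Coprime q m
prime∤⇒coprime q-prime q∤m {d} (d∣q , d∣m) with prime⇒irreducible q-prime d∣q
... | inj₁ d≡1  = d≡1
... | inj₂ refl = ⊥-elim (q∤m d∣m)

-- An invertible k has an inverse of the form 1 + B modulo M, i.e. M ∣ k(1+B) − 1.
-- From Bézout either k·x = 1 + yM (take 1+B = x), or xk = yM − 1, and then
-- k·(x·xk) = (xk)² ≡ 1 (when xk = 0 we have M ∣ 1 and any B works).
inverse-mod : ∀ {k M} → Coprime k M → ∃ λ B → M ∣ k * (1 + B) ∸ 1
inverse-mod {k} {M} k⊥M with coprime-Bézout k⊥M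
... | Bézout.+- zero    y ()
... | Bézout.+- (suc x) y eq = x , divides y (cong (_∸ 1) (trans (*-comm k (suc x)) (sym eq)))
... | Bézout.-+ x y eq = squareInverse x (x * k) refl (divides y eq)
  where
  square-shape : ∀ k x a → k * (suc x * suc a) ≡ (suc x * k) * suc a
  square-shape = solve-∀
  square-pred : ∀ a → a + a * suc a ≡ a * (1 + suc a)
  square-pred = solve-∀
  squareInverse : ∀ x a → a ≡ x * k → M ∣ 1 + a → ∃ λ B → M ∣ k * (1 + B) ∸ 1
  squareInverse x       zero    _  M∣1   = 0 , ∣-trans M∣1 (1∣ _)
  squareInverse zero    (suc a) ()
  squareInverse (suc x) (suc a) a≡ M∣1+a = a + x * suc a , subst (M ∣_) (sym k[1+B]∸1) (∣n⇒∣m*n a M∣1+a)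
    where
    k[1+B]∸1 : k * (suc x * suc a) ∸ 1 ≡ a * (1 + suc a)
    k[1+B]∸1 = trans (cong (_∸ 1) (trans (square-shape k x a) (cong (_* suc a) (sym a≡))))
                     (square-pred a)

-- If k(1+B) ≡ 1 (mod M) then M ∣ 1 + jk ⇔ M ∣ B + (j+1), since
-- k(B + j + 1) = (k(1+B) − 1) + (1 + jk) and k is invertible modulo M.
shift-divisibility : ∀ {M k B} j → 1 ≤ k → Coprime M k → M ∣ k * (1 + B) ∸ 1 →
                     (M ∣ 1 + j * k → M ∣ B + suc j) × (M ∣ B + suc j → M ∣ 1 + j * k)
shift-divisibility {M} {k} {B} j 1≤k M⊥k M∣k[1+B]∸1 =
  (λ M∣1+jk → coprime-divisor M⊥k (subst (M ∣_) (sym split) (∣m∣n⇒∣m+n M∣k[1+B]∸1 M∣1+jk))) ,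
  (λ M∣B+j+1 → ∣m+n∣m⇒∣n (subst (M ∣_) split (∣n⇒∣m*n k M∣B+j+1)) M∣k[1+B]∸1)
  where
  expand : ∀ k B j → k * (B + suc j) ≡ k * (1 + B) + j * k
  expand = solve-∀
  split : k * (B + suc j) ≡ (k * (1 + B) ∸ 1) + (1 + j * k)
  split = begin
    k * (B + suc j)                   ≡⟨ expand k B j ⟩
    k * (1 + B) + j * k               ≡⟨ cong (_+ j * k) (sym (m∸n+n≡m (≤-trans 1≤k (m≤m*n k (1 + B))))) ⟩
    (k * (1 + B) ∸ 1) + 1 + j * k     ≡⟨ +-assoc (k * (1 + B) ∸ 1) 1 (j * k) ⟩
    (k * (1 + B) ∸ 1) + (1 + j * k)   ∎
    where open ≡-Reasoning

countMultiples : ℕ → ℕ → ℕ → ℕ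
countMultiples d B zero    = 0
countMultiples d B (suc n) = countMultiples d B n + 𝟙 (d ∣? B + suc n)

/-unique : ∀ {m r q d} .{{_ : NonZero d}} → r < d → m ≡ r + q * d → m / d ≡ q
/-unique {r = r} {q} {d} r<d refl =
  trans (+-distrib-/-∣ʳ r (n∣m*n q)) (cong₂ _+_ (m<n⇒m/n≡0 r<d) (m*n/n≡m q d))

/-suc : ∀ m d .{{_ : NonZero d}} → suc m / d ≡ m / d + 𝟙 (d ∣? suc m)
/-suc m d = step (m % d) (m / d) (m≡m%n+[m/n]*n m d) (m%n<n m d) (d ∣? suc m)
  where
  step : ∀ r q → m ≡ r + q * d → r < d → (d∣? : Dec (d ∣ suc m)) → suc m / d ≡ q + 𝟙 d∣?
  step r q m≡ r<d d∣? with suc r ≟ d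
  step r q m≡ r<d (yes _)  | yes 1+r≡d =
    trans (/-unique (>-nonZero⁻¹ d) (trans (cong suc m≡) (cong (_+ q * d) 1+r≡d))) (+-comm 1 q)
  step r q m≡ r<d (no d∤)  | yes 1+r≡d =
    ⊥-elim (d∤ (divides (suc q) (trans (cong suc m≡) (cong (_+ q * d) 1+r≡d))))
  step r q m≡ r<d (yes d∣) | no 1+r≢d =
    ⊥-elim (<⇒≱ (≤∧≢⇒< r<d 1+r≢d) (∣⇒≤ (∣m+n∣m⇒∣n d∣q*d+1+r (n∣m*n q))))
    where
    d∣q*d+1+r : d ∣ q * d + suc r
    d∣q*d+1+r = subst (d ∣_) (trans (cong suc m≡) (+-comm (suc r) (q * d))) d∣
  step r q m≡ r<d (no _)   | no 1+r≢d =
    trans (/-unique (≤∧≢⇒< r<d 1+r≢d) (cong suc m≡)) (sym (+-identityʳ q))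

countMultiples-floor : ∀ d .{{_ : NonZero d}} B n → countMultiples d B n + B / d ≡ (B + n) / d
countMultiples-floor d B zero    = cong (_/ d) (sym (+-identityʳ B))
countMultiples-floor d B (suc n) = begin
  countMultiples d B n + [d∣] + B / d      ≡⟨ +-swap-last (countMultiples d B n) [d∣] (B / d) ⟩
  countMultiples d B n + B / d + [d∣]      ≡⟨ cong (_+ [d∣]) (countMultiples-floor d B n) ⟩
  (B + n) / d + [d∣]                       ≡⟨ cong (λ x → (B + n) / d + 𝟙 (d ∣? x)) (+-suc B n) ⟩
  (B + n) / d + 𝟙 (d ∣? suc (B + n))       ≡⟨ sym (/-suc (B + n) d) ⟩
  suc (B + n) / d                          ≡⟨ cong (_/ d) (sym (+-suc B n)) ⟩
  (B + suc n) / d                          ∎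
  where
  open ≡-Reasoning
  [d∣] : ℕ
  [d∣] = 𝟙 (d ∣? B + suc n)
  +-swap-last : ∀ a b c → a + b + c ≡ a + c + b
  +-swap-last = solve-∀

countMultiples-from-0 : ∀ d .{{_ : NonZero d}} n → countMultiples d 0 n ≡ n / d
countMultiples-from-0 d n =
  trans (sym (+-identityʳ _)) (trans (cong (countMultiples d 0 n +_) (sym (0/n≡0 d)))
        (countMultiples-floor d 0 n))

floor-superadditive : ∀ B n d .{{_ : NonZero d}} → B / d + n / d ≤ (B + n) / d
floor-superadditive B n d = subst (_≤ (B + n) / d) (m*n/n≡m (B / d + n / d) d)
  (/-monoˡ-≤ d (subst (_≤ B + n) (sym (*-distribʳ-+ d (B / d) (n / d)))
     (+-mono-≤ (m/n*n≤m B d) (m/n*n≤m n d))))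

countMultiples-shift-≥ : ∀ d .{{_ : NonZero d}} B n → countMultiples d 0 n ≤ countMultiples d B n
countMultiples-shift-≥ d B n = +-cancelʳ-≤ (B / d) _ _ (begin
  countMultiples d 0 n + B / d   ≡⟨ cong (_+ B / d) (countMultiples-from-0 d n) ⟩
  n / d + B / d                  ≡⟨ +-comm (n / d) (B / d) ⟩
  B / d + n / d                  ≤⟨ floor-superadditive B n d ⟩
  (B + n) / d                    ≡⟨ sym (countMultiples-floor d B n) ⟩
  countMultiples d B n + B / d   ∎)
  where open ≤-Reasoning

carry-div : ∀ B n d .{{_ : NonZero d}} → B < d → (B + n) / d ≡ n / d + 𝟙 (d ≤? B + n % d)
carry-div B n d B<d = begin
  (B + n) / d                          ≡⟨ cong (λ x → (B + x) / d) (m≡m%n+[m/n]*n n d) ⟩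
  (B + (n % d + n / d * d)) / d        ≡⟨ cong (_/ d) (sym (+-assoc B (n % d) _)) ⟩
  (B + n % d + n / d * d) / d          ≡⟨ +-distrib-/-∣ʳ (B + n % d) (n∣m*n (n / d)) ⟩
  (B + n % d) / d + n / d * d / d      ≡⟨ cong₂ _+_ (small-quotient (B + n % d) (+-mono-<-≤ B<d (m%n≤n n d)))
                                                     (m*n/n≡m (n / d) d) ⟩
  𝟙 (d ≤? B + n % d) + n / d           ≡⟨ +-comm _ (n / d) ⟩
  n / d + 𝟙 (d ≤? B + n % d)           ∎
  where
  open ≡-Reasoning
  small-quotient : ∀ x → x < d + d → x / d ≡ 𝟙 (d ≤? x)
  small-quotient x x<2d with d ≤? x
  ... | yes d≤x = trans (m/n≡1+[m∸n]/n d≤x) (cong suc (m<n⇒m/n≡0 (m<n+o⇒m∸n<o x d x<2d)))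
  ... | no  d≰x = m<n⇒m/n≡0 (≰⇒> d≰x)

^-mono-∣ : ∀ {a b} n → a ∣ b → a ^ n ∣ b ^ n
^-mono-∣ zero    a∣b = ∣-refl
^-mono-∣ (suc n) a∣b = *-pres-∣ a∣b (^-mono-∣ n a∣b)

module Valuation (p : ℕ) (p-prime : Prime p) where
  instance
    p≢0 : NonZero p
    p≢0 = prime⇒nonZero p-prime

  p^≢0 : ∀ i → NonZero (p ^ i)
  p^≢0 i = m^n≢0 p i

  1<p : 1 < p
  1<p = nonTrivial⇒n>1 p {{prime⇒nonTrivial p-prime}}

  p∤1 : ¬ p ∣ 1
  p∤1 p∣1 = <⇒≢ 1<p (sym (∣1⇒≡1 p∣1))

  record Val (X e : ℕ) : Set where
    constructor val
    field
      cofactor    : ℕ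
      factored    : X ≡ p ^ e * cofactor
      p∤cofactor  : ¬ p ∣ cofactor

  val-p-free : ∀ {X} → ¬ p ∣ X → Val X 0
  val-p-free {X} p∤X = val X (sym (*-identityˡ X)) p∤X

  val-exists : ∀ X → X ≢ 0 → ∃ (Val X)
  val-exists = <-rec (λ X → X ≢ 0 → ∃ (Val X)) step
    where
    regroup : ∀ a u p → a * u * p ≡ p * a * u
    regroup = solve-∀
    step : ∀ X → (∀ {Y} → Y < X → Y ≢ 0 → ∃ (Val Y)) → X ≢ 0 → ∃ (Val X)
    step X rec X≢0 with p ∣? X
    ... | no p∤X = 0 , val-p-free p∤X
    ... | yes (divides q refl) with rec (m<m*n q p {{≢-nonZero q≢0}} 1<p) q≢0
      where
      q≢0 : q ≢ 0
      q≢0 q≡0 = X≢0 (cong (_* p) q≡0)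
    ...   | e , val u q≡ p∤u = suc e , val u (trans (cong (_* p) q≡) (regroup (p ^ e) u p)) p∤u

  val-* : ∀ {X Y a b} → Val X a → Val Y b → Val (X * Y) (a + b)
  val-* {X} {Y} {a} {b} (val u X≡ p∤u) (val v Y≡ p∤v) = val (u * v) XY≡ p∤uv
    where
    regroup : ∀ x u y v → x * u * (y * v) ≡ x * y * (u * v)
    regroup = solve-∀
    XY≡ : X * Y ≡ p ^ (a + b) * (u * v)
    XY≡ = trans (cong₂ _*_ X≡ Y≡) (trans (regroup (p ^ a) u (p ^ b) v)
            (cong (_* (u * v)) (sym (^-distribˡ-+-* p a b))))
    p∤uv : ¬ p ∣ u * v
    p∤uv p∣uv with euclidsLemma u v p-prime p∣uv
    ... | inj₁ p∣u = p∤u p∣u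
    ... | inj₂ p∣v = p∤v p∣v

  p^e∣p^a : ∀ {e a} → e ≤ a → p ^ e ∣ p ^ a
  p^e∣p^a {zero}  {a}     z≤n       = 1∣ _
  p^e∣p^a {suc e} {suc a} (s≤s e≤a) = *-monoʳ-∣ p (p^e∣p^a e≤a)

  ≤⇒p^e∣ : ∀ {X a e} → Val X a → e ≤ a → p ^ e ∣ X
  ≤⇒p^e∣ {X} {a} {e} (val u X≡ _) e≤a = subst (p ^ e ∣_) (sym X≡) (∣m⇒∣m*n u (p^e∣p^a e≤a))

  p^e∣⇒≤ : ∀ {X a e} → Val X a → p ^ e ∣ X → e ≤ a
  p^e∣⇒≤ {X} {a} {e} (val u X≡ p∤u) p^e∣X = bound a e (subst (p ^ e ∣_) X≡ p^e∣X)
    where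
    bound : ∀ a e → p ^ e ∣ p ^ a * u → e ≤ a
    bound a       zero    _ = z≤n
    bound zero    (suc e) d = ⊥-elim (p∤u (∣-trans (m∣m*n (p ^ e)) (subst (p * p ^ e ∣_) (*-identityˡ u) d)))
    bound (suc a) (suc e) d = s≤s (bound a e (*-cancelˡ-∣ p (subst (p * p ^ e ∣_) (*-assoc p (p ^ a) u) d)))

  val-unique : ∀ {X a b} → Val X a → Val X b → a ≡ b
  val-unique va vb = ≤-antisym (p^e∣⇒≤ vb (≤⇒p^e∣ va ≤-refl)) (p^e∣⇒≤ va (≤⇒p^e∣ vb ≤-refl))

  val-cancel : ∀ {X Y a b} → X ≢ 0 → Val (X * Y) (a + b) → Val Y b → Val X a
  val-cancel {X} {Y} {a} {b} X≢0 vXY vY with val-exists X X≢0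
  ... | a′ , vX = subst (Val X) (+-cancelʳ-≡ b a′ a (val-unique (val-* vX vY) vXY)) vX

  -- ν_p(X) < X for X ≠ 0, because e < pᵉ ≤ X.
  val< : ∀ {X e} → X ≢ 0 → Val X e → e < X
  val< {X} {e} X≢0 (val u X≡ _) = <-≤-trans (e<p^e e) p^e≤X
    where
    e<p^e : ∀ e → e < p ^ e
    e<p^e zero    = z<s
    e<p^e (suc e) = ≤-<-trans (e<p^e e) (subst (p ^ e <_) (*-comm (p ^ e) p) (m<m*n (p ^ e) p {{p^≢0 e}} 1<p))
    u≢0 : u ≢ 0
    u≢0 u≡0 = X≢0 (trans X≡ (trans (cong (p ^ e *_) u≡0) (*-zeroʳ (p ^ e))))
    p^e≤X : p ^ e ≤ X
    p^e≤X = subst (p ^ e ≤_) (sym X≡) (m≤m*n (p ^ e) u {{≢-nonZero u≢0}})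

  val-count : ∀ {X e} T → Val X e → e ≤ T → sumTo T (λ i → 𝟙 (p ^ suc i ∣? X)) ≡ e
  val-count {X} {e} T vX e≤T =
    trans (sumTo-cong T (λ i → 𝟙-cong (p ^ suc i ∣? X) (suc i ≤? e) (p^e∣⇒≤ vX) (≤⇒p^e∣ vX)))
          (trans (sumTo-threshold T e) (m≥n⇒m⊓n≡n e≤T))

  -- Given Bᵢ with
  -- k(1+Bᵢ) ≡ 1 (mod p^{i+1}), the factors 1+jk divisible by p^{i+1} correspond to
  -- the multiples of p^{i+1} in (Bᵢ, Bᵢ+n]; summing over levels i < T gives ν_p,
  -- provided T exceeds every ν_p(1+jk), which nk ≤ T guarantees.
  module RisingProduct (k : ℕ) (1≤k : 1 ≤ k) (p∤k : ¬ p ∣ k) (B : ℕ → ℕ)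
                       (B-inv : ∀ i → p ^ suc i ∣ k * (1 + B i) ∸ 1) where

    level-count : ℕ → ℕ → ℕ
    level-count n i = countMultiples (p ^ suc i) (B i) n

    val-risingProd : ∀ n T → n * k ≤ T → Val (risingProd n k) (sumTo T (level-count n))
    val-risingProd zero    T _ = subst (Val 1) (sym (sumTo-zero T)) (val-p-free p∤1)
    val-risingProd (suc n) T [1+n]k≤T =
      subst₂ Val (sym (risingProd-suc n k)) exponent (val-* vR vF)
      where
      vR : Val (risingProd n k) (sumTo T (level-count n))
      vR = val-risingProd n T (≤-trans (m≤n+m (n * k) k) [1+n]k≤T)
      factor : ∃ (Val (1 + n * k))
      factor = val-exists (1 + n * k) (λ ())
      eF : ℕ
      eF = proj₁ factor
      vF : Val (1 + n * k) eF
      vF = proj₂ factor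
      eF≤T : eF ≤ T
      eF≤T = ≤-trans (≤-pred (val< (λ ()) vF)) (≤-trans (m≤n+m (n * k) k) [1+n]k≤T)
      same-level : ∀ i → 𝟙 (p ^ suc i ∣? B i + suc n) ≡ 𝟙 (p ^ suc i ∣? 1 + n * k)
      same-level i = 𝟙-cong _ _ (proj₂ shift) (proj₁ shift)
        where
        shift : (p ^ suc i ∣ 1 + n * k → p ^ suc i ∣ B i + suc n) × (p ^ suc i ∣ B i + suc n → p ^ suc i ∣ 1 + n * k)
        shift = shift-divisibility n 1≤k (coprime-^ (suc i) (prime∤⇒coprime p-prime p∤k)) (B-inv i)
      exponent : sumTo T (level-count n) + eF ≡ sumTo T (level-count (suc n))
      exponent = sym (trans (sumTo-+ T (level-count n) (λ i → 𝟙 (p ^ suc i ∣? B i + suc n)))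
                   (cong (sumTo T (level-count n) +_)
                     (trans (sumTo-cong T same-level) (val-count T vF eF≤T))))

  -- Legendre's formula ν_p(n!) = Σ_{i<T} ⌊n/p^{i+1}⌋ (in counting form), the case k = 1, Bᵢ = 0.
  val-factorial : ∀ n T → n ≤ T → Val (n !) (sumTo T (λ i → countMultiples (p ^ suc i) 0 n))
  val-factorial n T n≤T = subst (λ X → Val X (sumTo T (λ i → countMultiples (p ^ suc i) 0 n))) (risingProd-1 n)
    (RisingProduct.val-risingProd 1 ≤-refl p∤1 (λ _ → 0) (λ i → (p ^ suc i) ∣0) n T
      (subst (_≤ T) (sym (*-identityʳ n)) n≤T))

  -- Σ_{i<T} ⌊n/p^{i+1}⌋ ≤ n, since each term is at most half of the previous quotient.
  legendre-bound : ∀ n T → sumTo T (λ i → countMultiples (p ^ suc i) 0 n) ≤ n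
  legendre-bound n T = begin
    sumTo T (λ i → countMultiples (p ^ suc i) 0 n) ≡⟨ sumTo-cong T (λ i → countMultiples-from-0 (p ^ suc i) {{p^≢0 (suc i)}} n) ⟩
    sumTo T (λ i → quot (suc i))                   ≤⟨ m≤m+n _ _ ⟩
    sumTo T (λ i → quot (suc i)) + quot T           ≤⟨ with-tail T ⟩
    n                                              ∎
    where
    open ≤-Reasoning
    quot : ℕ → ℕ
    quot i = _/_ n (p ^ i) {{p^≢0 i}}
    quot-suc : ∀ i → quot (suc i) ≡ quot i / p
    quot-suc i = sym (trans (m/n/o≡m/[n*o] n (p ^ i) p {{p^≢0 i}} {{p≢0}} {{p^i*p≢0}})
                            (/-congʳ {{p^i*p≢0}} {{p^≢0 (suc i)}} (*-comm (p ^ i) p)))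
      where
      p^i*p≢0 : NonZero (p ^ i * p)
      p^i*p≢0 = m*n≢0 (p ^ i) p {{p^≢0 i}}
    halving : ∀ m → m / p + m / p ≤ m
    halving m = begin
      m / p + m / p       ≡⟨ cong (m / p +_) (sym (+-identityʳ (m / p))) ⟩
      2 * (m / p)         ≤⟨ *-monoˡ-≤ (m / p) 1<p ⟩
      p * (m / p)         ≡⟨ *-comm p (m / p) ⟩
      m / p * p           ≤⟨ m/n*n≤m m p ⟩
      m                   ∎
    with-tail : ∀ T → sumTo T (λ i → quot (suc i)) + quot T ≤ n
    with-tail zero    = ≤-reflexive (n/1≡n n)
    with-tail (suc T) = begin
      sumTo T (λ i → quot (suc i)) + quot (suc T) + quot (suc T)   ≡⟨ +-assoc (sumTo T (λ i → quot (suc i))) _ _ ⟩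
      sumTo T (λ i → quot (suc i)) + (quot (suc T) + quot (suc T)) ≤⟨ +-monoʳ-≤ _ (subst (λ x → x + x ≤ quot T) (sym (quot-suc T)) (halving (quot T))) ⟩
      sumTo T (λ i → quot (suc i)) + quot T                        ≤⟨ with-tail T ⟩
      n                                                            ∎

  -- If p ∣ k then ν_p(n!) ≤ n ≤ ν_p(kⁿ); otherwise each level of Legendre's count is
  -- dominated by the corresponding level count for the rising product.
  p-part-integral : ∀ k n → 1 ≤ k → ∀ e → p ^ e ∣ n ! → p ^ e ∣ k ^ n * risingProd n k
  p-part-integral k n 1≤k e p^e∣n! with p ∣? k
  ... | yes p∣k = ∣m⇒∣m*n (risingProd n k) (∣-trans (p^e∣p^a e≤n) (^-mono-∣ n p∣k))
    where
    e≤n : e ≤ n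
    e≤n = ≤-trans (p^e∣⇒≤ {e = e} (val-factorial n n ≤-refl) p^e∣n!) (legendre-bound n n)
  ... | no p∤k = ∣n⇒∣m*n (k ^ n) (≤⇒p^e∣ vR (≤-trans (p^e∣⇒≤ {e = e} vF p^e∣n!) level-wise))
    where
    T : ℕ
    T = n * k + n
    inverse : ∀ i → ∃ λ B → p ^ suc i ∣ k * (1 + B) ∸ 1
    inverse i = inverse-mod (coprime-sym (coprime-^ (suc i) (prime∤⇒coprime p-prime p∤k)))
    B : ℕ → ℕ
    B i = proj₁ (inverse i)
    vR : Val (risingProd n k) (sumTo T (λ i → countMultiples (p ^ suc i) (B i) n))
    vR = RisingProduct.val-risingProd k 1≤k p∤k B (λ i → proj₂ (inverse i)) n T (m≤m+n _ _)
    vF : Val (n !) (sumTo T (λ i → countMultiples (p ^ suc i) 0 n))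
    vF = val-factorial n T (m≤n+m n (n * k))
    level-wise : sumTo T (λ i → countMultiples (p ^ suc i) 0 n) ≤ sumTo T (λ i → countMultiples (p ^ suc i) (B i) n)
    level-wise = sumTo-mono T (λ i → countMultiples-shift-≥ (p ^ suc i) {{p^≢0 (suc i)}} (B i) n)

-- A product of primes divides X as soon as every prime power dividing it divides X:
-- peel off one prime q (q ∣ X), and pass to X / q.
product-∣ : ∀ qs X → All Prime qs → (∀ r e → Prime r → r ^ e ∣ product qs → r ^ e ∣ X) → product qs ∣ X
product-∣ []       X _                     _ = 1∣ X
product-∣ (q ∷ qs) X (q-prime ∷ qs-prime) h with subst (_∣ X) (*-identityʳ q) (h q 1 q-prime q¹∣)
  where
  q¹∣ : q ^ 1 ∣ q * product qs
  q¹∣ = subst (_∣ q * product qs) (sym (*-identityʳ q)) (m∣m*n (product qs))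
... | divides X′ refl = subst (q * product qs ∣_) (*-comm q X′) (*-monoʳ-∣ q (product-∣ qs X′ qs-prime h′))
  where
  instance
    q≢0 : NonZero q
    q≢0 = prime⇒nonZero q-prime
  h′ : ∀ r e → Prime r → r ^ e ∣ product qs → r ^ e ∣ X′
  h′ r e r-prime r^e∣ with r ≟ q
  ... | yes refl = *-cancelˡ-∣ q (subst (q * q ^ e ∣_) (*-comm X′ q) (h q (suc e) q-prime (*-monoʳ-∣ q r^e∣)))
  ... | no  r≢q  = coprime-divisor (coprime-^ e (prime∤⇒coprime r-prime r∤q))
                     (subst (r ^ e ∣_) (*-comm X′ q) (h r e r-prime (∣n⇒∣m*n q r^e∣)))
    where
    r∤q : ¬ r ∣ q
    r∤q r∣q with prime⇒irreducible q-prime r∣q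
    ... | inj₁ refl = nonTrivial⇒≢1 {{prime⇒nonTrivial r-prime}} refl
    ... | inj₂ r≡q  = r≢q r≡q

divides-via-prime-powers : ∀ D X .{{_ : NonZero D}} → (∀ q e → Prime q → q ^ e ∣ D → q ^ e ∣ X) → D ∣ X
divides-via-prime-powers D X h = subst (_∣ X) (sym isFactorisation)
  (product-∣ factors X factorsPrime (λ q e q-prime q^e∣ → h q e q-prime (subst (q ^ e ∣_) (sym isFactorisation) q^e∣)))
  where open PrimeFactorisation (factorise D)

-- c(n,k) is an integer: n! ∣ kⁿ · ∏_{j<n}(1+jk), checked one prime at a time.
factorial-∣ : ∀ k n → 1 ≤ k → n ! ∣ k ^ n * risingProd n k
factorial-∣ k n 1≤k = divides-via-prime-powers (n !) (k ^ n * risingProd n k) {{n !≢0}}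
  (λ q e q-prime → Valuation.p-part-integral q q-prime k n 1≤k e)

module BaseP (p : ℕ) .{{p≢0 : NonZero p}} where

  p^≢0 : ∀ i → NonZero (p ^ i)
  p^≢0 i = m^n≢0 p i

  _/p^_ : ℕ → ℕ → ℕ
  x /p^ i = _/_ x (p ^ i) {{p^≢0 i}}

  _%p^_ : ℕ → ℕ → ℕ
  x %p^ i = _%_ x (p ^ i) {{p^≢0 i}}

  digit≡ : ∀ n m → digit p n m ≡ (n /p^ m) % p
  digit≡ n zero    = cong (_% p) (sym (n/1≡n n))
  digit≡ n (suc m) = trans (digit≡ (n / p) m)
    (cong (_% p) (m/n/o≡m/[n*o] n p (p ^ m) {{p≢0}} {{p^≢0 m}} {{p^≢0 (suc m)}}))

  %p^-suc : ∀ n m → n %p^ suc m ≡ digit p n m * p ^ m + n %p^ m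
  %p^-suc n m = begin
    x                          ≡⟨ m≡m%n+[m/n]*n x (p ^ m) {{p^≢0 m}} ⟩
    x %p^ m + x /p^ m * p ^ m  ≡⟨ cong₂ (λ u v → u + v * p ^ m) low-digits top-digit ⟩
    n %p^ m + digit p n m * p ^ m  ≡⟨ +-comm (n %p^ m) _ ⟩
    digit p n m * p ^ m + n %p^ m  ∎
    where
    open ≡-Reasoning
    x : ℕ
    x = n %p^ suc m
    low-digits : x %p^ m ≡ n %p^ m
    low-digits = m∣n⇒o%n%m≡o%m (p ^ m) (p ^ suc m) n {{p^≢0 m}} {{p^≢0 (suc m)}} (n∣m*n p)
    top-digit : x /p^ m ≡ digit p n m
    top-digit = trans (m%[n*o]/o≡m/o%n n p (p ^ m) {{p≢0}} {{p^≢0 m}} {{p^≢0 (suc m)}}) (sym (digit≡ n m))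

  module Carries (b : ℕ → ℕ) (b<p : ∀ m → b m < p) (n : ℕ) where

    β : ℕ → ℕ
    β = partialSum p b

    β< : ∀ i → β i < p ^ i
    β< zero    = z<s
    β< (suc i) = begin-strict
      β (suc i)                ≡⟨ partialSum-suc p b i ⟩
      β i + b i * p ^ i        <⟨ +-monoˡ-< (b i * p ^ i) (β< i) ⟩
      suc (b i) * p ^ i        ≤⟨ *-monoˡ-≤ (p ^ i) (b<p i) ⟩
      p * p ^ i                ∎
      where open ≤-Reasoning

    -- carry i is the carry out of digit i when adding β and n in base p.
    carry : ℕ → ℕ
    carry i = 𝟙 (p ^ suc i ≤? β (suc i) + n %p^ suc i)

    column : ∀ i → β (suc i) + n %p^ suc i ≡ (β i + n %p^ i) + (digit p n i + b i) * p ^ i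
    column i = trans (cong₂ _+_ (partialSum-suc p b i) (%p^-suc n i))
                     (regroup (β i) (b i) (p ^ i) (digit p n i) (n %p^ i))
      where
      regroup : ∀ s bi d a r → (s + bi * d) + (a * d + r) ≡ (s + r) + (a + bi) * d
      regroup = solve-∀

    incoming< : ∀ i → β i + n %p^ i < p ^ i + p ^ i
    incoming< i = +-mono-<-≤ (β< i) (m%n≤n n (p ^ i) {{p^≢0 i}})

    carry-lower : ∀ i → 𝟙 (p ≤? digit p n i + b i) ≤ carry i
    carry-lower i = 𝟙-mono (p ≤? digit p n i + b i) (p ^ suc i ≤? _)
      (λ p≤ab → subst (p ^ suc i ≤_) (sym (column i))
                  (≤-trans (*-monoˡ-≤ (p ^ i) p≤ab) (m≤n+m _ (β i + n %p^ i))))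

    -- aᵢ + bᵢ < p − 1 rules out a carry, since the incoming part is below 2pⁱ.
    carry-upper : ∀ i → carry i ≤ 𝟙 (p ∸ 1 ≤? digit p n i + b i)
    carry-upper i = 𝟙-mono (p ^ suc i ≤? _) (p ∸ 1 ≤? ab)
      (λ big → decidable-stable (p ∸ 1 ≤? ab) (λ small → <⇒≱ (no-carry small) big))
      where
      ab : ℕ
      ab = digit p n i + b i
      two-more : ∀ d a → d + d + a * d ≡ suc (suc a) * d
      two-more = solve-∀
      no-carry : ¬ (p ∸ 1 ≤ ab) → β (suc i) + n %p^ suc i < p ^ suc i
      no-carry small = begin-strict
        β (suc i) + n %p^ suc i          ≡⟨ column i ⟩
        (β i + n %p^ i) + ab * p ^ i     <⟨ +-monoˡ-< (ab * p ^ i) (incoming< i) ⟩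
        p ^ i + p ^ i + ab * p ^ i       ≡⟨ two-more (p ^ i) ab ⟩
        suc (suc ab) * p ^ i             ≤⟨ *-monoˡ-≤ (p ^ i) ab+2≤p ⟩
        p * p ^ i                        ∎
        where
        open ≤-Reasoning
        ab+2≤p : suc (suc ab) ≤ p
        ab+2≤p = ≤-trans (s≤s (≰⇒> small)) (≤-reflexive (trans (+-comm 1 (p ∸ 1)) (m∸n+n≡m (>-nonZero⁻¹ p))))

    carry-count : ∀ i → countMultiples (p ^ suc i) (β (suc i)) n ≡ countMultiples (p ^ suc i) 0 n + carry i
    carry-count i = begin
      countMultiples d (β (suc i)) n                           ≡⟨ sym (+-identityʳ _) ⟩
      countMultiples d (β (suc i)) n + 0                       ≡⟨ cong (countMultiples d (β (suc i)) n +_) (sym (m<n⇒m/n≡0 (β< (suc i)))) ⟩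
      countMultiples d (β (suc i)) n + β (suc i) / d           ≡⟨ countMultiples-floor d (β (suc i)) n ⟩
      (β (suc i) + n) / d                                      ≡⟨ carry-div (β (suc i)) n d (β< (suc i)) ⟩
      n / d + carry i                                          ≡⟨ cong (_+ carry i) (sym (countMultiples-from-0 d n)) ⟩
      countMultiples d 0 n + carry i                           ∎
      where
      open ≡-Reasoning
      d : ℕ
      d = p ^ suc i
      instance
        d≢0 : NonZero d
        d≢0 = p^≢0 (suc i)

-- ν_p(c(n,k)) is the number of carries when adding 1/k − 1 and n in base p:
-- from c(n,k)·n! = kⁿ·∏(1+jk), ν_p(kⁿ) = 0 and the level-wise comparison carry-count.
module ValuationOfC (k p n : ℕ) (1≤k : 1 ≤ k) (p-prime : Prime p) (p∤k : ¬ p ∣ k)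
                    (b : ℕ → ℕ) (b<p : ∀ m → b m < p)
                    (b-inv : ∀ M → p ^ M ∣ k * (1 + partialSum p b M) ∸ 1) where
  open Valuation p p-prime
  open BaseP p
  open Carries b b<p n

  c·n!≡ : c n k * n ! ≡ k ^ n * risingProd n k
  c·n!≡ = m/n*n≡m {{n !≢0}} (factorial-∣ k n 1≤k)

  c≢0 : c n k ≢ 0
  c≢0 c≡0 with m*n≡0⇒m≡0∨n≡0 (k ^ n) (trans (sym c·n!≡) (cong (_* n !) c≡0))
  ... | inj₁ kⁿ≡0 = <⇒≢ 1≤k (sym (m^n≡0⇒m≡0 k n kⁿ≡0))
  ... | inj₂ R≡0  = risingProd≢0 n k R≡0

  p∤kⁿ : ¬ p ∣ k ^ n
  p∤kⁿ p∣kⁿ = <⇒≢ 1<p (sym (coprime-^ n (coprime-sym (prime∤⇒coprime p-prime p∤k)) (p∣kⁿ , ∣-refl)))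

  -- Enough levels: T₀ ≥ nk bounds every ν_p(1+jk), and T₀ ≥ n serves Legendre's formula.
  T₀ : ℕ
  T₀ = n * k + n

  -- ν_p(c(n,k)) = Σ_{i<T} carryᵢ: subtract Legendre's count from the rising-product count.
  val-c : ∀ T → T₀ ≤ T → Val (c n k) (sumTo T carry)
  val-c T T≥ = val-cancel c≢0 (subst₂ Val (sym c·n!≡) exponent (val-* (val-p-free p∤kⁿ) vR)) vF
    where
    legendre : ℕ → ℕ
    legendre i = countMultiples (p ^ suc i) 0 n
    vF : Val (n !) (sumTo T legendre)
    vF = val-factorial n T (≤-trans (m≤n+m n (n * k)) T≥)
    vR : Val (risingProd n k) (sumTo T (λ i → countMultiples (p ^ suc i) (β (suc i)) n))
    vR = RisingProduct.val-risingProd k 1≤k p∤k (λ i → β (suc i)) (λ i → b-inv (suc i)) n T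
           (≤-trans (m≤m+n (n * k) n) T≥)
    exponent : 0 + sumTo T (λ i → countMultiples (p ^ suc i) (β (suc i)) n) ≡ sumTo T carry + sumTo T legendre
    exponent = trans (sumTo-cong T carry-count) (trans (sumTo-+ T legendre carry) (+-comm (sumTo T legendre) _))

  lower-bound : ∀ L → p ^ countGE p (digit p n) b L ∣ c n k
  lower-bound L = ≤⇒p^e∣ (val-c (L + T₀) (m≤n+m T₀ L)) (begin
    countGE p (digit p n) b L                   ≡⟨ countGE≡sumTo p (digit p n) b L ⟩
    sumTo L (λ m → 𝟙 (p ≤? digit p n m + b m))  ≤⟨ sumTo-mono L carry-lower ⟩
    sumTo L carry                               ≤⟨ sumTo-extend carry (m≤m+n L T₀) ⟩
    sumTo (L + T₀) carry                        ∎)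
    where open ≤-Reasoning

  upper-bound : ¬ (p ^ suc (countGE (p ∸ 1) (digit p n) b T₀) ∣ c n k)
  upper-bound p^∣c = <⇒≱ (s≤s carries≤v₂) (p^e∣⇒≤ {e = suc v₂} (val-c T₀ ≤-refl) p^∣c)
    where
    v₂ : ℕ
    v₂ = countGE (p ∸ 1) (digit p n) b T₀
    carries≤v₂ : sumTo T₀ carry ≤ v₂
    carries≤v₂ = ≤-trans (sumTo-mono T₀ carry-upper) (≤-reflexive (sym (countGE≡sumTo (p ∸ 1) (digit p n) b T₀)))

corollary3p8 : (k p n : ℕ) → 1 ≤ k → Prime p → .{{_ : NonZero p}} → ¬ (p ∣ k) →
    (b : ℕ → ℕ) → IsInvDigits p k b →
      ((L : ℕ) → p ^ countGE p (digit p n) b L ∣ c n k)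
      × ∃ (λ L → ¬ (p ^ suc (countGE (p ∸ 1) (digit p n) b L) ∣ c n k))
corollary3p8 k p n 1≤k p-prime p∤k b (b<p , b-inv) = lower-bound , (T₀ , upper-bound)
  where open ValuationOfC k p n 1≤k p-prime p∤k b b<p b-inv
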